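{- Every switchboard $(M,<)$ can be expanded to a labeled switchboard $(M,<,\uparrow,\downarrow)$.
   Context: For a set $M$, $[M]^2$ is the set of 2-element subsets of $M$. A switchboard is a set $M$ with a strict partial order $<$ on $[M]^2$ such that for distinct $x,y,z\in M$, $\{x,y\}$ and $\{x,z\}$ are incomparable. A labeled switchboard is $(M,<,\uparrow,\downarrow)$ where: $(M,<)$ is a switchboard; $\uparrow,\downarrow$ are binary relations between $M$ and $[M]^2$; (Trichotomy) for every $a\in M$ and $\{b,c\}\in[M]^2$ exactly one of $a\uparrow\{b,c\}$, $a\in\{b,c\}$, $a\downarrow\{b,c\}$ holds; (Upward) if $a\uparrow\{b,c\}$ and $\{b,c\}<\{b',c'\}$ then $a\uparrow\{b',c'\}$; (Downward) if $a\downarrow\{b,c\}$ and $\{b,c\}>\{b',c'\}$ then $a\downarrow\{b',c'\}$. -}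

module Defs where

open import Level using (0ℓ)
open import Data.Product using (Σ; _×_; _,_; proj₁; proj₂)
open import Data.Sum using (_⊎_)
open import Data.Empty using (⊥)
open import Relation.Nullary using (¬_)
open import Relation.Binary.PropositionalEquality using (_≡_; _≢_)

-- [M]^2 : 2-element subsets of M, represented by ordered pairs of distinct
-- elements; two representatives denote the same subset iff related by _≈₂_.
[_]² : Set → Set
[ M ]² = Σ (M × M) (λ p → proj₁ p ≢ proj₂ p)

module _ {M : Set} where

  fst₂ snd₂ : [ M ]² → M
  fst₂ p = proj₁ (proj₁ p)
  snd₂ p = proj₂ (proj₁ p)

  _≈₂_ : [ M ]² → [ M ]² → Set
  p ≈₂ q = (fst₂ p ≡ fst₂ q × snd₂ p ≡ snd₂ q) ⊎ (fst₂ p ≡ snd₂ q × snd₂ p ≡ fst₂ q)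

  _∈₂_ : M → [ M ]² → Set
  a ∈₂ p = a ≡ fst₂ p ⊎ a ≡ snd₂ p

  ⟅_,_⟆⟨_⟩ : (x y : M) → x ≢ y → [ M ]²
  ⟅ x , y ⟆⟨ d ⟩ = (x , y) , d

record Switchboard (M : Set) : Set₁ where
  field
    _<_     : [ M ]² → [ M ]² → Set
    -- _<_ is a relation on 2-subsets, i.e. independent of representatives
    <-resp  : ∀ {p p′ q q′} → p ≈₂ p′ → q ≈₂ q′ → p < q → p′ < q′
    <-irrefl : ∀ {p q} → p ≈₂ q → ¬ (p < q)
    <-trans : ∀ {p q r} → p < q → q < r → p < r
    incomparable : ∀ {x y z} (xy : x ≢ y) (xz : x ≢ z) (yz : y ≢ z) →
                   ¬ (⟅ x , y ⟆⟨ xy ⟩ < ⟅ x , z ⟆⟨ xz ⟩)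

record Labeling {M : Set} (S : Switchboard M) : Set₁ where
  open Switchboard S
  field
    _↑_ : M → [ M ]² → Set
    _↓_ : M → [ M ]² → Set
    -- relations between M and 2-subsets: independent of representatives
    ↑-resp : ∀ {a p q} → p ≈₂ q → a ↑ p → a ↑ q
    ↓-resp : ∀ {a p q} → p ≈₂ q → a ↓ p → a ↓ q
    tri      : ∀ a p → a ↑ p ⊎ a ∈₂ p ⊎ a ↓ p
    ¬↑∧∈     : ∀ {a p} → a ↑ p → a ∈₂ p → ⊥
    ¬↑∧↓     : ∀ {a p} → a ↑ p → a ↓ p → ⊥
    ¬∈∧↓     : ∀ {a p} → a ∈₂ p → a ↓ p → ⊥
    upward   : ∀ {a p q} → a ↑ p → p < q → a ↑ q
    downward : ∀ {a p q} → a ↓ p → q < p → a ↓ q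

{-# OPTIONS --safe #-}
-- Let a ↑ p hold when some 2-subset containing a lies below p, and a ↓ p when
-- a ∉ p and no such 2-subset exists. Two 2-subsets with a common element are
-- incomparable (by the switchboard axiom if they differ, by irreflexivity if
-- they coincide), so a ↑ p excludes a ∈ p; the upward and downward laws follow
-- from transitivity, and trichotomy from excluded middle.
module Submission where

open import Defs
open import Level using (0ℓ)
open import Axiom.ExcludedMiddle using (ExcludedMiddle)
open import Data.Product using (Σ; _×_; _,_)
open import Data.Sum using (_⊎_; inj₁; inj₂)
open import Relation.Nullary using (¬_; yes; no)
open import Relation.Nullary.Decidable using (¬¬-excluded-middle)
open import Relation.Binary.PropositionalEquality using (_≡_; _≢_; refl; sym; trans)

module _ {M : Set} where

  ≈₂-refl : {p : [ M ]²} → p ≈₂ p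
  ≈₂-refl = inj₁ (refl , refl)

  ≈₂-sym : {p q : [ M ]²} → p ≈₂ q → q ≈₂ p
  ≈₂-sym (inj₁ (e₁ , e₂)) = inj₁ (sym e₁ , sym e₂)
  ≈₂-sym (inj₂ (e₁ , e₂)) = inj₂ (sym e₂ , sym e₁)

  ∈₂-resp-≈₂ : {a : M} {p q : [ M ]²} → p ≈₂ q → a ∈₂ p → a ∈₂ q
  ∈₂-resp-≈₂ (inj₁ (e₁ , _)) (inj₁ a≡p₁) = inj₁ (trans a≡p₁ e₁)
  ∈₂-resp-≈₂ (inj₁ (_ , e₂)) (inj₂ a≡p₂) = inj₂ (trans a≡p₂ e₂)
  ∈₂-resp-≈₂ (inj₂ (e₁ , _)) (inj₁ a≡p₁) = inj₂ (trans a≡p₁ e₁)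
  ∈₂-resp-≈₂ (inj₂ (_ , e₂)) (inj₂ a≡p₂) = inj₁ (trans a≡p₂ e₂)

  ∉₂-resp-≈₂ : {a : M} {p q : [ M ]²} → p ≈₂ q → ¬ a ∈₂ p → ¬ a ∈₂ q
  ∉₂-resp-≈₂ {a} {p} {q} p≈q a∉p a∈q =
    a∉p (∈₂-resp-≈₂ {a = a} {q} {p} (≈₂-sym {p} {q} p≈q) a∈q)

  ∈₂⇒≈₂⟅_,-⟆ : (a : M) {p : [ M ]²} → a ∈₂ p →
               Σ M λ x → Σ (a ≢ x) λ a≢x → p ≈₂ ⟅ a , x ⟆⟨ a≢x ⟩
  ∈₂⇒≈₂⟅ a ,-⟆ {(_ , x) , a≢x} (inj₁ refl) = x , a≢x , inj₁ (refl , refl)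
  ∈₂⇒≈₂⟅ a ,-⟆ {(x , _) , x≢a} (inj₂ refl) = x , (λ a≡x → x≢a (sym a≡x)) , inj₂ (refl , refl)

module _ {M : Set} (S : Switchboard M) where
  open Switchboard S

  -- The goal is ⊥, so the case split on x ≡ y needs no excluded middle.
  incomparable-or-equal : {a x y : M} (a≢x : a ≢ x) (a≢y : a ≢ y) →
                          ¬ ⟅ a , x ⟆⟨ a≢x ⟩ < ⟅ a , y ⟆⟨ a≢y ⟩
  incomparable-or-equal {x = x} {y} a≢x a≢y ax<ay = ¬¬-excluded-middle {A = x ≡ y} λ where
    (yes refl) → <-irrefl (inj₁ (refl , refl)) ax<ay
    (no x≢y)   → incomparable a≢x a≢y x≢y ax<ay

  common-element⇒≮ : {a : M} {p q : [ M ]²} → a ∈₂ p → a ∈₂ q → ¬ p < q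
  common-element⇒≮ {a} {p} {q} a∈p a∈q p<q
    with ∈₂⇒≈₂⟅ a ,-⟆ {p} a∈p | ∈₂⇒≈₂⟅ a ,-⟆ {q} a∈q
  ... | _ , a≢x , p≈ax | _ , a≢y , q≈ay =
    incomparable-or-equal a≢x a≢y (<-resp p≈ax q≈ay p<q)

  OccursBelow : M → [ M ]² → Set
  OccursBelow a p = Σ [ M ]² λ q → a ∈₂ q × q < p

  OccursBelow-resp-≈₂ : {a : M} {p q : [ M ]²} → p ≈₂ q → OccursBelow a p → OccursBelow a q
  OccursBelow-resp-≈₂ p≈q (r , a∈r , r<p) = r , a∈r , <-resp (≈₂-refl {p = r}) p≈q r<p

  OccursBelow-mono-< : {a : M} {p q : [ M ]²} → OccursBelow a p → p < q → OccursBelow a q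
  OccursBelow-mono-< (r , a∈r , r<p) p<q = r , a∈r , <-trans r<p p<q

  OccursBelow⇒∉₂ : {a : M} {p : [ M ]²} → OccursBelow a p → ¬ a ∈₂ p
  OccursBelow⇒∉₂ (r , a∈r , r<p) a∈p = common-element⇒≮ a∈r a∈p r<p

  Avoids : M → [ M ]² → Set
  Avoids a p = ¬ a ∈₂ p × ¬ OccursBelow a p

  Avoids-resp-≈₂ : {a : M} {p q : [ M ]²} → p ≈₂ q → Avoids a p → Avoids a q
  Avoids-resp-≈₂ {a = a} {p} {q} p≈q (a∉p , ¬below) =
    ∉₂-resp-≈₂ {a = a} {p} {q} p≈q a∉p ,
    λ below → ¬below (OccursBelow-resp-≈₂ {a} {q} {p} (≈₂-sym {p = p} {q} p≈q) below)

  Avoids-anti-< : {a : M} {p q : [ M ]²} → Avoids a p → q < p → Avoids a q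
  Avoids-anti-< (_ , ¬below) q<p =
    (λ a∈q → ¬below (_ , a∈q , q<p)) , λ below → ¬below (OccursBelow-mono-< below q<p)

  OccursBelow-∈₂-Avoids-trichotomy : ExcludedMiddle 0ℓ → ∀ a p →
    OccursBelow a p ⊎ a ∈₂ p ⊎ Avoids a p
  OccursBelow-∈₂-Avoids-trichotomy em a p with em {a ∈₂ p} | em {OccursBelow a p}
  ... | yes a∈p | _           = inj₂ (inj₁ a∈p)
  ... | no a∉p  | yes below   = inj₁ below
  ... | no a∉p  | no ¬below   = inj₂ (inj₂ (a∉p , ¬below))

proposition4p9 : ExcludedMiddle 0ℓ → {M : Set} → (S : Switchboard M) → Labeling S
proposition4p9 em S = record
  { _↑_      = OccursBelow S
  ; _↓_      = Avoids S
  ; ↑-resp   = OccursBelow-resp-≈₂ S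
  ; ↓-resp   = Avoids-resp-≈₂ S
  ; tri      = OccursBelow-∈₂-Avoids-trichotomy S em
  ; ¬↑∧∈     = OccursBelow⇒∉₂ S
  ; ¬↑∧↓     = λ below (_ , ¬below) → ¬below below
  ; ¬∈∧↓     = λ a∈p (a∉p , _) → a∉p a∈p
  ; upward   = OccursBelow-mono-< S
  ; downward = Avoids-anti-< S
  }
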